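{- Let $k\geq3$ be an integer and let $S_k$ be the unique positive real root of $x^2-kx-1=0$. For $n\geq1$ let $M_{k,n}=[\underbrace{k,\ldots,k}_{n}]$, $m_{k,n}=[\underbrace{k,\ldots,k}_{n},1]$, and let $G_{k,n}=\left(M_{k,n}+m_{k,n},\,2M_{k,n+1}\right)$ if $n$ is odd and $G_{k,n}=\left(2M_{k,n+1},\,M_{k,n}+m_{k,n}\right)$ if $n$ is even. Then for every $x\in\bigcup_{n=1}^\infty G_{k,2n-1}$ and every $y\in\bigcup_{n=1}^\infty G_{k,2n}$ we have $x<2S_k^{ -1}<y$.
   Context: $[a_1,\ldots,a_n]$ denotes the finite regular continued fraction $1/(a_1+1/(\cdots+1/a_n))$.
   Formalization: The points x and y of the unions of the intervals $G_{k,n}$ range only over the rationals rather than over all real numbers. -}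

module Defs where

open import Data.Nat as ℕ using (ℕ; zero; suc)
open import Data.Integer as ℤ using (ℤ; +_; +0; +[1+_]; -[1+_])
open import Data.Rational using (ℚ; mkℚ; _/_; _+_; _*_; _<_; _≤_; 0ℚ; 1ℚ)
open import Data.List using (List; []; _∷_; replicate; _++_; [_])
open import Data.Bool using (Bool; true; false; if_then_else_)
open import Data.Product using (_×_)
open import Data.Sum using (_⊎_)

-- total reciprocal on ℚ (convention 1/0 = 0; never used on 0 below,
-- since all continued-fraction partial sums here are positive)
inv : ℚ → ℚ
inv (mkℚ +0 d _) = 0ℚ
inv (mkℚ +[1+ n ] d _) = (+ suc d) / suc n
inv (mkℚ -[1+ n ] d _) = -[1+ d ] / suc n

-- [a₁,…,aₙ] = 1/(a₁ + 1/(⋯ + 1/aₙ)),  with [] = 0 so that [a] = 1/a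
cf : List ℚ → ℚ
cf [] = 0ℚ
cf (a ∷ as) = inv (a + cf as)

ℕ→ℚ : ℕ → ℚ
ℕ→ℚ k = (+ k) / 1

two : ℚ
two = ℕ→ℚ 2

M : ℕ → ℕ → ℚ
M k n = cf (replicate n (ℕ→ℚ k))

m : ℕ → ℕ → ℚ
m k n = cf (replicate n (ℕ→ℚ k) ++ [ 1ℚ ])

isOdd : ℕ → Bool
isOdd zero = false
isOdd (suc zero) = true
isOdd (suc (suc n)) = isOdd n

InOpen : ℚ → ℚ → ℚ → Set
InOpen a b x = (a < x) × (x < b)

InG : ℕ → ℕ → ℚ → Set
InG k n x = if isOdd n
  then InOpen (M k n + m k n) (two * M k (suc n)) x
  else InOpen (two * M k (suc n)) (M k n + m k n) x

-- S_k = positive root of x² - kx - 1 = 0, given by its Dedekind cut: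
-- q < S_k  iff  q < 0 or q² - kq - 1 < 0
LtS : ℕ → ℚ → Set
LtS k q = (q < 0ℚ) ⊎ (q * q < ℕ→ℚ k * q + 1ℚ)

-- S_k < q  iff  q > 0 and q² - kq - 1 > 0
GtS : ℕ → ℚ → Set
GtS k q = (0ℚ < q) × (ℕ→ℚ k * q + 1ℚ < q * q)

-- x < 2 S_k⁻¹  iff  x ≤ 0, or x > 0 and S_k < 2/x
Lt2invS : ℕ → ℚ → Set
Lt2invS k x = (x ≤ 0ℚ) ⊎ ((0ℚ < x) × GtS k (two * inv x))

-- 2 S_k⁻¹ < y  iff  y > 0 and 2/y < S_k
Gt2invS : ℕ → ℚ → Set
Gt2invS k y = (0ℚ < y) × LtS k (two * inv y)

{-# OPTIONS --safe #-}
module Submission where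

-- Since S_k² = k S_k + 1, the number 1/S_k is the positive root of P t = t² + k t = 1,
-- so a nonnegative t lies below 1/S_k iff P t < 1.  For a ≥ 0 and b = 1/(k + a) one has
-- P a = a (k + a), P b = b (k + b) and 1 = b (k + a), so P a < 1 iff a < b iff P b > 1:
-- the map a ↦ 1/(k + a) swaps the two sides of the root.  Hence M_{k,n} = 1/(k + M_{k,n-1}),
-- starting from M_{k,0} = 0, lies below 1/S_k for even n and above it for odd n.  Only the
-- endpoint 2 M_{k,n+1} of G_{k,n} matters: x < 2 M_{k,2n} < 2/S_k and y > 2 M_{k,2n+1} > 2/S_k.

open import Data.Bool using (true; false; not)
open import Data.Product using (_×_; _,_; proj₁; proj₂)
open import Data.Sum using (inj₁; inj₂)
open import Relation.Binary.PropositionalEquality using (_≡_; refl; sym; trans; cong; subst)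
open import Relation.Nullary using (yes; no)
open import Data.Nat using (ℕ; zero; suc)
import Data.Nat as ℕ
open import Data.Rational using (ℚ)
open import Defs

module _ where
  open import Data.Integer using (+[1+_])
  open import Data.Rational
    using (mkℚ; _+_; _*_; _<_; _≤_; 0ℚ; 1ℚ; ½; 1/_; Positive; NonZero; positive; nonNegative)
  open import Data.Rational.Properties
  open import Data.Rational.Solver using (module +-*-Solver)
  open import Data.Nat.Coprimality using () renaming (sym to coprime-sym)
  open +-*-Solver
  open ≤-Reasoning

  inv≡1/ : ∀ c .{{_ : NonZero c}} .{{_ : Positive c}} → inv c ≡ 1/ c
  inv≡1/ (mkℚ +[1+ _ ] _ coprime) = normalize-coprime (coprime-sym coprime)

  module _ {c : ℚ} (0<c : 0ℚ < c) where
    private instance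
      c-pos : Positive c
      c-pos = positive 0<c
      c-nonZero : NonZero c
      c-nonZero = pos⇒nonZero c

    inv-pos : 0ℚ < inv c
    inv-pos = subst (0ℚ <_) (sym (inv≡1/ c)) (positive⁻¹ (1/ c) {{1/pos⇒pos c}})

    inv-inverseˡ : inv c * c ≡ 1ℚ
    inv-inverseˡ = trans (cong (_* c) (inv≡1/ c)) (*-inverseˡ c)

  ℕ→ℚ-nonNeg : ∀ k → 0ℚ ≤ ℕ→ℚ k
  ℕ→ℚ-nonNeg k = nonNegative⁻¹ (ℕ→ℚ k) {{normalize-nonNeg k 1}}

  ℕ→ℚ-pos : ∀ k .{{_ : ℕ.NonZero k}} → 0ℚ < ℕ→ℚ k
  ℕ→ℚ-pos k = positive⁻¹ (ℕ→ℚ k) {{normalize-pos k 1}}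

  P : ℚ → ℚ → ℚ
  P K t = t * t + K * t

  BelowRoot : ℚ → ℚ → Set
  BelowRoot K a = (0ℚ ≤ a) × (P K a < 1ℚ)

  AboveRoot : ℚ → ℚ → Set
  AboveRoot K b = (0ℚ < b) × (1ℚ < P K b)

  P-factor : ∀ K t → P K t ≡ t * (K + t)
  P-factor = solve 2 (λ K t → t :* t :+ K :* t := t :* (K :+ t)) refl

  P-mono-< : ∀ {K u v} → 0ℚ ≤ K → 0ℚ ≤ u → u < v → P K u < P K v
  P-mono-< {K} {u} {v} 0≤K 0≤u u<v = +-mono-<-≤ u²<v² Ku≤Kv
    where
    u²<v² : u * u < v * v
    u²<v² = begin-strict
      u * u  ≤⟨ *-monoˡ-≤-nonNeg u {{nonNegative 0≤u}} (<⇒≤ u<v) ⟩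
      u * v  <⟨ *-monoˡ-<-pos v {{positive (≤-<-trans 0≤u u<v)}} u<v ⟩
      v * v  ∎
    Ku≤Kv : K * u ≤ K * v
    Ku≤Kv = *-monoˡ-≤-nonNeg K {{nonNegative 0≤K}} (<⇒≤ u<v)

  BelowRoot⇒AboveRoot-inv : ∀ {K a} → 0ℚ < K → BelowRoot K a → AboveRoot K (inv (K + a))
  BelowRoot⇒AboveRoot-inv {K} {a} 0<K (0≤a , Pa<1) = 0<b , (begin-strict
      1ℚ           ≡⟨ sym b[K+a]≡1 ⟩
      b * (K + a)  <⟨ *-monoʳ-<-pos b {{positive 0<b}} (+-monoʳ-< K a<b) ⟩
      b * (K + b)  ≡⟨ sym (P-factor K b) ⟩
      P K b        ∎)
    where
    0<K+a = +-mono-<-≤ 0<K 0≤a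
    b = inv (K + a)
    0<b = inv-pos 0<K+a
    b[K+a]≡1 = inv-inverseˡ 0<K+a
    a<b : a < b
    a<b = *-cancelʳ-<-nonNeg (K + a) {{nonNegative (<⇒≤ 0<K+a)}} (begin-strict
      a * (K + a)  ≡⟨ sym (P-factor K a) ⟩
      P K a        <⟨ Pa<1 ⟩
      1ℚ           ≡⟨ sym b[K+a]≡1 ⟩
      b * (K + a)  ∎)

  AboveRoot⇒BelowRoot-inv : ∀ {K a} → 0ℚ < K → AboveRoot K a → BelowRoot K (inv (K + a))
  AboveRoot⇒BelowRoot-inv {K} {a} 0<K (0<a , 1<Pa) = <⇒≤ 0<b , (begin-strict
      P K b        ≡⟨ P-factor K b ⟩
      b * (K + b)  <⟨ *-monoʳ-<-pos b {{positive 0<b}} (+-monoʳ-< K b<a) ⟩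
      b * (K + a)  ≡⟨ b[K+a]≡1 ⟩
      1ℚ           ∎)
    where
    0<K+a = +-mono-< 0<K 0<a
    b = inv (K + a)
    0<b = inv-pos 0<K+a
    b[K+a]≡1 = inv-inverseˡ 0<K+a
    b<a : b < a
    b<a = *-cancelʳ-<-nonNeg (K + a) {{nonNegative (<⇒≤ 0<K+a)}} (begin-strict
      b * (K + a)  ≡⟨ b[K+a]≡1 ⟩
      1ℚ           <⟨ 1<Pa ⟩
      P K a        ≡⟨ P-factor K a ⟩
      a * (K + a)  ∎)

  BelowRoot-0 : ∀ K → BelowRoot K 0ℚ
  BelowRoot-0 K =
    ≤-refl , subst (_< 1ℚ) (sym (trans (P-factor K 0ℚ) (*-zeroˡ (K + 0ℚ)))) (positive⁻¹ 1ℚ)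

  *-pos : ∀ {p q} → 0ℚ < p → 0ℚ < q → 0ℚ < p * q
  *-pos {p} {q} 0<p 0<q = positive⁻¹ (p * q) {{pos*pos⇒pos p {{positive 0<p}} q {{positive 0<q}}}}

  P-scaled : ∀ K t {q} → t * q ≡ 1ℚ → P K t * (q * q) ≡ K * q + 1ℚ
  P-scaled K t {q} tq≡1 = begin-equality
    P K t * (q * q)                      ≡⟨ solve 3 (λ K t q → (t :* t :+ K :* t) :* (q :* q)
                                              := (t :* q) :* (t :* q) :+ K :* q :* (t :* q)) refl K t q ⟩
    (t * q) * (t * q) + K * q * (t * q)  ≡⟨ cong (λ s → s * s + K * q * s) tq≡1 ⟩
    1ℚ * 1ℚ + K * q * 1ℚ                 ≡⟨ solve 2 (λ K q → con 1ℚ :* con 1ℚ :+ K :* q :* con 1ℚ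
                                              := K :* q :+ con 1ℚ) refl K q ⟩
    K * q + 1ℚ                           ∎

  P<1⇒GtS : ∀ k t {q} → t * q ≡ 1ℚ → 0ℚ < q → P (ℕ→ℚ k) t < 1ℚ → GtS k q
  P<1⇒GtS k t {q} tq≡1 0<q Pt<1 = 0<q , (begin-strict
    ℕ→ℚ k * q + 1ℚ         ≡⟨ sym (P-scaled (ℕ→ℚ k) t tq≡1) ⟩
    P (ℕ→ℚ k) t * (q * q)  <⟨ *-monoˡ-<-pos (q * q) {{positive (*-pos 0<q 0<q)}} Pt<1 ⟩
    1ℚ * (q * q)           ≡⟨ *-identityˡ (q * q) ⟩
    q * q                  ∎)

  1<P⇒LtS : ∀ k t {q} → t * q ≡ 1ℚ → 0ℚ < q → 1ℚ < P (ℕ→ℚ k) t → LtS k q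
  1<P⇒LtS k t {q} tq≡1 0<q 1<Pt = inj₂ (begin-strict
    q * q                  ≡⟨ sym (*-identityˡ (q * q)) ⟩
    1ℚ * (q * q)           <⟨ *-monoˡ-<-pos (q * q) {{positive (*-pos 0<q 0<q)}} 1<Pt ⟩
    P (ℕ→ℚ k) t * (q * q)  ≡⟨ P-scaled (ℕ→ℚ k) t tq≡1 ⟩
    ℕ→ℚ k * q + 1ℚ         ∎)

  two-*-½ : ∀ a → two * a * ½ ≡ a
  two-*-½ = solve 1 (λ a → con two :* a :* con ½ := a) refl

  half-*-two-inv : ∀ {x} → 0ℚ < x → x * ½ * (two * inv x) ≡ 1ℚ
  half-*-two-inv {x} 0<x =
    trans (solve 2 (λ x y → x :* con ½ :* (con two :* y) := y :* x) refl x (inv x)) (inv-inverseˡ 0<x)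

  0<two*inv : ∀ {x} → 0ℚ < x → 0ℚ < two * inv x
  0<two*inv 0<x = *-pos (positive⁻¹ two) (inv-pos 0<x)

  BelowRoot⇒Lt2invS : ∀ k {a x} → BelowRoot (ℕ→ℚ k) a → x < two * a → Lt2invS k x
  BelowRoot⇒Lt2invS k {a} {x} (_ , Pa<1) x<2a with x ≤? 0ℚ
  ... | yes x≤0 = inj₁ x≤0
  ... | no  x≰0 = inj₂ (0<x , P<1⇒GtS k (x * ½) (half-*-two-inv 0<x) (0<two*inv 0<x) Pt<1)
    where
    0<x = ≰⇒> x≰0
    t<a : x * ½ < a
    t<a = begin-strict
      x * ½        <⟨ *-monoˡ-<-pos ½ x<2a ⟩
      two * a * ½  ≡⟨ two-*-½ a ⟩
      a            ∎
    Pt<1 = <-trans (P-mono-< (ℕ→ℚ-nonNeg k) (<⇒≤ (*-pos 0<x (positive⁻¹ ½))) t<a) Pa<1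

  AboveRoot⇒Gt2invS : ∀ k {b y} → AboveRoot (ℕ→ℚ k) b → two * b < y → Gt2invS k y
  AboveRoot⇒Gt2invS k {b} {y} (0<b , 1<Pb) 2b<y =
    0<y , 1<P⇒LtS k (y * ½) (half-*-two-inv 0<y) (0<two*inv 0<y) 1<Pt
    where
    0<y = <-trans (*-pos (positive⁻¹ two) 0<b) 2b<y
    b<t : b < y * ½
    b<t = begin-strict
      b            ≡⟨ sym (two-*-½ b) ⟩
      two * b * ½  <⟨ *-monoˡ-<-pos ½ 2b<y ⟩
      y * ½        ∎
    1<Pt = <-trans 1<Pb (P-mono-< (ℕ→ℚ-nonNeg k) (<⇒≤ 0<b) b<t)

  InG-odd : ∀ k n {x} → isOdd n ≡ true → InG k n x → InOpen (M k n + m k n) (two * M k (suc n)) x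
  InG-odd _ _ odd x∈G rewrite odd = x∈G

  InG-even : ∀ k n {y} → isOdd n ≡ false → InG k n y → InOpen (two * M k (suc n)) (M k n + m k n) y
  InG-even _ _ even y∈G rewrite even = y∈G

open import Data.Nat using (_≤_; _*_)
open import Data.Nat.Properties using (*-suc)

isOdd-suc : ∀ n → isOdd (suc n) ≡ not (isOdd n)
isOdd-suc zero = refl
isOdd-suc (suc zero) = refl
isOdd-suc (suc (suc n)) = isOdd-suc n

isOdd-2* : ∀ n → isOdd (2 * n) ≡ false
isOdd-2* zero = refl
isOdd-2* (suc n) rewrite *-suc 2 n = isOdd-2* n

isOdd-1+2* : ∀ n → isOdd (suc (2 * n)) ≡ true
isOdd-1+2* n = trans (isOdd-suc (2 * n)) (cong not (isOdd-2* n))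

module _ (k : ℕ) .{{_ : ℕ.NonZero k}} where
  mutual
    M-even-below : ∀ j → BelowRoot (ℕ→ℚ k) (M k (2 * j))
    M-even-below zero = BelowRoot-0 (ℕ→ℚ k)
    M-even-below (suc j) = subst (λ i → BelowRoot (ℕ→ℚ k) (M k i)) (sym (*-suc 2 j))
      (AboveRoot⇒BelowRoot-inv (ℕ→ℚ-pos k) (M-odd-above j))

    M-odd-above : ∀ j → AboveRoot (ℕ→ℚ k) (M k (suc (2 * j)))
    M-odd-above j = BelowRoot⇒AboveRoot-inv (ℕ→ℚ-pos k) (M-even-below j)

proposition2 : (k : ℕ) → 3 ≤ k →
    ((n : ℕ) (x : ℚ) → InG k (suc (2 * n)) x → Lt2invS k x)
    × ((n : ℕ) (y : ℚ) → InG k (2 * suc n) y → Gt2invS k y)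
proposition2 zero ()
proposition2 k@(suc _) _ =
    (λ n x x∈G → BelowRoot⇒Lt2invS k (AboveRoot⇒BelowRoot-inv (ℕ→ℚ-pos k) (M-odd-above k n))
                   (proj₂ (InG-odd k (suc (2 * n)) (isOdd-1+2* n) x∈G)))
  , (λ n y y∈G → AboveRoot⇒Gt2invS k (M-odd-above k (suc n))
                   (proj₁ (InG-even k (2 * suc n) (isOdd-2* (suc n)) y∈G)))
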